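{- For every integer $k \geq 1$, $\mathrm{Dist}(\Omega_{2k}) > 2$.
   Context: The orthogonality graph $\Omega_{2k}$ has vertex set $\mathbb{Z}_2^{2k}$ (bitstrings of length $2k$), with two vertices adjacent if and only if their bitstrings differ in exactly $k$ positions. A labeling $f: V(G)\to\{1,\dots,d\}$ of a graph $G$ is $d$-distinguishing if the only automorphism of $G$ preserving every label class is the identity; $\mathrm{Dist}(G)$ is the least $d$ for which $G$ has a $d$-distinguishing labeling. -}

module Defs where

open import Data.Nat using (ℕ; zero; suc; _+_; _*_; _≤_)
open import Data.Bool using (Bool; true; false; _xor_)
open import Data.Vec using (Vec; []; _∷_)
open import Data.Fin using (Fin)
open import Data.Product using (_×_)
open import Relation.Binary.PropositionalEquality using (_≡_)
open import Relation.Nullary using (¬_)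

record Graph : Set₁ where
  field
    V   : Set
    Adj : V → V → Set

open Graph public

hamming : ∀ {n} → Vec Bool n → Vec Bool n → ℕ
hamming []       []       = 0
hamming (a ∷ u) (b ∷ v) with a xor b
... | true  = suc (hamming u v)
... | false = hamming u v

-- The orthogonality graph Ω_{2k}: vertices Z_2^{2k}, adjacent iff the
-- bitstrings differ in exactly k positions.
Ω : ℕ → Graph
Ω k = record { V = Vec Bool (2 * k) ; Adj = λ x y → hamming x y ≡ k }

record Automorphism (G : Graph) : Set where
  field
    to       : V G → V G
    from     : V G → V G
    to-from  : ∀ x → to (from x) ≡ x
    from-to  : ∀ x → from (to x) ≡ x
    adj-to   : ∀ x y → Adj G x y → Adj G (to x) (to y)
    adj-from : ∀ x y → Adj G (to x) (to y) → Adj G x y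

open Automorphism public

Distinguishing : (G : Graph) (d : ℕ) → (V G → Fin d) → Set
Distinguishing G d f =
  (σ : Automorphism G) → (∀ x → f (to σ x) ≡ f x) → ∀ x → to σ x ≡ x

-- Dist(G) > m  ⇔  for no d ≤ m does G have a d-distinguishing labeling
-- (Dist(G) is the least d admitting a d-distinguishing labeling).
DistGreaterThan : Graph → ℕ → Set
DistGreaterThan G m = ∀ d → d ≤ m → (f : V G → Fin d) → ¬ Distinguishing G d f

-- Since z ↦ z̄ (complement) turns Hamming distance h into 2k − h, it preserves distance k;
-- hence for any Hamming isometry g, every map sending each z to g z or to its complement
-- preserves adjacency, and is an automorphism as soon as it is an involution.
-- Swapping z and z̄ whenever they carry the same label is such a map, so under a
-- distinguishing labeling no vertex shares its label with its complement. With at most two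
-- labels, z̄ then always carries the other label of z, so one of g z, g z̄ has the label of z
-- (g flipping the first bit); choosing it gives a label-preserving involutive automorphism
-- without fixed points.
module Submission where

open import Defs
open import Data.Nat using (ℕ; suc; _+_; _*_; _≤_; z≤n; s≤s)
open import Data.Nat.Properties using (+-suc; +-identityʳ; +-cancelʳ-≡; 1+n≢0; m+1+n≢0)
open import Data.Bool using (Bool; true; false; not; if_then_else_)
open import Data.Bool.Properties using (not-involutive)
open import Data.Vec using (Vec; []; _∷_; map; replicate)
open import Data.Vec.Properties using (∷-injectiveʳ)
open import Data.Fin using (Fin; zero; suc; _≟_)
open import Data.Sum using (_⊎_; inj₁; inj₂)
open import Data.Empty using (⊥-elim)
open import Function using (id)
open import Level using (0ℓ)
open import Relation.Unary using (Pred; Decidable)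
open import Relation.Nullary using (¬_; yes; no; does; ¬?)
open import Relation.Nullary.Decidable using (toSum)
open import Relation.Binary.PropositionalEquality

private
  variable
    n d : ℕ

complement : Vec Bool n → Vec Bool n
complement = map not

complement-involutive : (v : Vec Bool n) → complement (complement v) ≡ v
complement-involutive []      = refl
complement-involutive (b ∷ v) = cong₂ _∷_ (not-involutive b) (complement-involutive v)

complement≡id⇒n≡0 : {v : Vec Bool n} → complement v ≡ v → n ≡ 0
complement≡id⇒n≡0 {v = []}        _  = refl
complement≡id⇒n≡0 {v = true ∷ _}  ()
complement≡id⇒n≡0 {v = false ∷ _} ()

hamming-complementˡ : (u v : Vec Bool n) → hamming (complement u) v + hamming u v ≡ n
hamming-complementˡ []          []          = refl
hamming-complementˡ (true ∷ u)  (true ∷ v)  = cong suc (hamming-complementˡ u v)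
hamming-complementˡ (true ∷ u)  (false ∷ v) = trans (+-suc _ _) (cong suc (hamming-complementˡ u v))
hamming-complementˡ (false ∷ u) (true ∷ v)  = trans (+-suc _ _) (cong suc (hamming-complementˡ u v))
hamming-complementˡ (false ∷ u) (false ∷ v) = cong suc (hamming-complementˡ u v)

hamming-complement : (u v : Vec Bool n) → hamming (complement u) (complement v) ≡ hamming u v
hamming-complement []          []          = refl
hamming-complement (true ∷ u)  (true ∷ v)  = hamming-complement u v
hamming-complement (true ∷ u)  (false ∷ v) = cong suc (hamming-complement u v)
hamming-complement (false ∷ u) (true ∷ v)  = cong suc (hamming-complement u v)
hamming-complement (false ∷ u) (false ∷ v) = hamming-complement u v

hamming-complementʳ : (u v : Vec Bool n) → hamming u (complement v) + hamming u v ≡ n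
hamming-complementʳ u v = begin
  hamming u (complement v) + hamming u v
    ≡⟨ cong (_+ hamming u v) (sym (hamming-complement u (complement v))) ⟩
  hamming (complement u) (complement (complement v)) + hamming u v
    ≡⟨ cong (λ w → hamming (complement u) w + hamming u v) (complement-involutive v) ⟩
  hamming (complement u) v + hamming u v
    ≡⟨ hamming-complementˡ u v ⟩
  _ ∎
  where open ≡-Reasoning

x+k≡2k⇒x≡k : ∀ x k → x + k ≡ 2 * k → x ≡ k
x+k≡2k⇒x≡k x k e = +-cancelʳ-≡ k x k (trans e (cong (k +_) (+-identityʳ k)))

Adj-complementˡ : ∀ k u v → Adj (Ω k) u v → Adj (Ω k) (complement u) v
Adj-complementˡ k u v h =
  x+k≡2k⇒x≡k _ k (subst (λ t → hamming (complement u) v + t ≡ 2 * k) h (hamming-complementˡ u v))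

Adj-complementʳ : ∀ k u v → Adj (Ω k) u v → Adj (Ω k) u (complement v)
Adj-complementʳ k u v h =
  x+k≡2k⇒x≡k _ k (subst (λ t → hamming u (complement v) + t ≡ 2 * k) h (hamming-complementʳ u v))

UpToComplement : Vec Bool n → Vec Bool n → Set
UpToComplement u u′ = u′ ≡ u ⊎ u′ ≡ complement u

Adj-resp-UpToComplement : ∀ k {u u′ v v′} → UpToComplement u u′ → UpToComplement v v′ →
                          Adj (Ω k) u v → Adj (Ω k) u′ v′
Adj-resp-UpToComplement k         (inj₁ refl) (inj₁ refl) h = h
Adj-resp-UpToComplement k {u} {v = v} (inj₁ refl) (inj₂ refl) h = Adj-complementʳ k u v h
Adj-resp-UpToComplement k {u} {v = v} (inj₂ refl) (inj₁ refl) h = Adj-complementˡ k u v h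
Adj-resp-UpToComplement k {u} {v = v} (inj₂ refl) (inj₂ refl) h =
  Adj-complementʳ k (complement u) v (Adj-complementˡ k u v h)

Isometry : (Vec Bool n → Vec Bool n) → Set
Isometry g = ∀ u v → hamming (g u) (g v) ≡ hamming u v

involution⇒Automorphism : (G : Graph) (τ : V G → V G) → (∀ x → τ (τ x) ≡ x) →
                          (∀ x y → Adj G x y → Adj G (τ x) (τ y)) → Automorphism G
involution⇒Automorphism G τ τ-inv τ-adj = record
  { to       = τ
  ; from     = τ
  ; to-from  = τ-inv
  ; from-to  = τ-inv
  ; adj-to   = τ-adj
  ; adj-from = λ x y h → subst₂ (Adj G) (τ-inv x) (τ-inv y) (τ-adj (τ x) (τ y) h)
  }

twist : (Vec Bool n → Vec Bool n) → {P : Pred (Vec Bool n) 0ℓ} → Decidable P →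
        Vec Bool n → Vec Bool n
twist g P? z = if does (P? z) then complement (g z) else g z

module _ (g : Vec Bool n → Vec Bool n) {P : Pred (Vec Bool n) 0ℓ} (P? : Decidable P) where

  twist-yes : ∀ {z} → P z → twist g P? z ≡ complement (g z)
  twist-yes {z} p with P? z
  ... | yes _  = refl
  ... | no ¬p  = ⊥-elim (¬p p)

  twist-no : ∀ {z} → ¬ P z → twist g P? z ≡ g z
  twist-no {z} ¬p with P? z
  ... | yes p = ⊥-elim (¬p p)
  ... | no _  = refl

  twist-UpToComplement : ∀ z → UpToComplement (g z) (twist g P? z)
  twist-UpToComplement z with P? z
  ... | yes _ = inj₂ refl
  ... | no _  = inj₁ refl

twist-preserves-Adj : ∀ k {g : Vec Bool (2 * k) → Vec Bool (2 * k)} → Isometry g →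
                      {P : Pred (Vec Bool (2 * k)) 0ℓ} (P? : Decidable P) →
                      ∀ x y → Adj (Ω k) x y → Adj (Ω k) (twist g P? x) (twist g P? y)
twist-preserves-Adj k {g} g-iso P? x y h =
  Adj-resp-UpToComplement k (twist-UpToComplement g P? x) (twist-UpToComplement g P? y)
                            (trans (g-iso x y) h)

module _ (k : ℕ) (f : Vec Bool (2 * k) → Fin d) where

  private
    shared? : Decidable (λ z → f z ≡ f (complement z))
    shared? z = f z ≟ f (complement z)

  swapShared : Vec Bool (2 * k) → Vec Bool (2 * k)
  swapShared = twist id shared?

  swapShared-shared : ∀ {z} → f z ≡ f (complement z) → swapShared z ≡ complement z
  swapShared-shared = twist-yes id shared?

  swapShared-involutive : ∀ z → swapShared (swapShared z) ≡ z
  swapShared-involutive z with toSum (shared? z)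
  ... | inj₁ shared = begin
    swapShared (swapShared z)  ≡⟨ cong swapShared (swapShared-shared shared) ⟩
    swapShared (complement z)  ≡⟨ swapShared-shared shared̄ ⟩
    complement (complement z)  ≡⟨ complement-involutive z ⟩
    z                          ∎
    where
      open ≡-Reasoning
      shared̄ : f (complement z) ≡ f (complement (complement z))
      shared̄ = trans (sym shared) (cong f (sym (complement-involutive z)))
  ... | inj₂ ¬shared = trans (cong swapShared eq) eq
    where
      eq : swapShared z ≡ z
      eq = twist-no id shared? ¬shared

  swapShared-preserves-labels : ∀ z → f (swapShared z) ≡ f z
  swapShared-preserves-labels z with toSum (shared? z)
  ... | inj₁ shared = trans (cong f (swapShared-shared shared)) (sym shared)
  ... | inj₂ ¬shared = cong f (twist-no id shared? ¬shared)

  swapSharedAutomorphism : Automorphism (Ω k)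
  swapSharedAutomorphism = involution⇒Automorphism (Ω k) swapShared swapShared-involutive
                             (twist-preserves-Adj k (λ _ _ → refl) shared?)

Distinguishing⇒label≢complement-label : ∀ {k} (f : Vec Bool (2 * suc k) → Fin d) →
                                        Distinguishing (Ω (suc k)) d f →
                                        ∀ z → f z ≢ f (complement z)
Distinguishing⇒label≢complement-label {k = k} f D z shared = 1+n≢0 (complement≡id⇒n≡0 swap-fixes-z)
  where
    swap-fixes-z : complement z ≡ z
    swap-fixes-z = trans (sym (swapShared-shared (suc k) f shared))
                         (D (swapSharedAutomorphism (suc k) f) (swapShared-preserves-labels (suc k) f) z)

≢∧≢⇒≡ : d ≤ 2 → {a b c : Fin d} → a ≢ b → b ≢ c → a ≡ c
≢∧≢⇒≡ (s≤s z≤n)       {zero}     {zero}     {zero}     _   _   = refl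
≢∧≢⇒≡ (s≤s (s≤s z≤n)) {zero}     {suc zero} {zero}     _   _   = refl
≢∧≢⇒≡ (s≤s (s≤s z≤n)) {suc zero} {zero}     {suc zero} _   _   = refl
≢∧≢⇒≡ (s≤s (s≤s z≤n)) {zero}     {zero}     {_}        a≢b _   = ⊥-elim (a≢b refl)
≢∧≢⇒≡ (s≤s (s≤s z≤n)) {suc zero} {suc zero} {_}        a≢b _   = ⊥-elim (a≢b refl)
≢∧≢⇒≡ (s≤s (s≤s z≤n)) {zero}     {suc zero} {suc zero} _   b≢c = ⊥-elim (b≢c refl)
≢∧≢⇒≡ (s≤s (s≤s z≤n)) {suc zero} {zero}     {zero}     _   b≢c = ⊥-elim (b≢c refl)

flipHead : Vec Bool (suc n) → Vec Bool (suc n)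
flipHead (b ∷ v) = not b ∷ v

flipHead-involutive : (z : Vec Bool (suc n)) → flipHead (flipHead z) ≡ z
flipHead-involutive (b ∷ v) = cong (_∷ v) (not-involutive b)

flipHead-isometry : Isometry (flipHead {n})
flipHead-isometry (true ∷ u)  (true ∷ v)  = refl
flipHead-isometry (true ∷ u)  (false ∷ v) = refl
flipHead-isometry (false ∷ u) (true ∷ v)  = refl
flipHead-isometry (false ∷ u) (false ∷ v) = refl

flipHead-complement : (z : Vec Bool (suc n)) → flipHead (complement z) ≡ complement (flipHead z)
flipHead-complement (b ∷ v) = refl

flipHead-≢ : (z : Vec Bool (suc n)) → flipHead z ≢ z
flipHead-≢ (true ∷ v)  ()
flipHead-≢ (false ∷ v) ()

complement-flipHead≡id⇒n≡0 : (z : Vec Bool (suc n)) → complement (flipHead z) ≡ z → n ≡ 0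
complement-flipHead≡id⇒n≡0 (b ∷ v) eq = complement≡id⇒n≡0 (∷-injectiveʳ eq)

module _ {k : ℕ} (d≤2 : d ≤ 2) (f : Vec Bool (2 * suc k) → Fin d)
         (separates : ∀ z → f z ≢ f (complement z)) where

  private
    mismatch? : Decidable (λ z → f (flipHead z) ≢ f z)
    mismatch? z = ¬? (f (flipHead z) ≟ f z)

    complement-matches : ∀ z → f (flipHead z) ≢ f z → f (complement (flipHead z)) ≡ f z
    complement-matches z mismatch =
      sym (≢∧≢⇒≡ d≤2 (λ eq → mismatch (sym eq)) (separates (flipHead z)))

  -- Sends z to whichever of flipHead z and its complement has the label of z.
  matchLabel : Vec Bool (2 * suc k) → Vec Bool (2 * suc k)
  matchLabel = twist flipHead mismatch?

  matchLabel-preserves-labels : ∀ z → f (matchLabel z) ≡ f z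
  matchLabel-preserves-labels z with toSum (f (flipHead z) ≟ f z)
  ... | inj₁ match    = trans (cong f (twist-no flipHead mismatch? (λ m → m match))) match
  ... | inj₂ mismatch =
    trans (cong f (twist-yes flipHead mismatch? mismatch)) (complement-matches z mismatch)

  matchLabel-involutive : ∀ z → matchLabel (matchLabel z) ≡ z
  matchLabel-involutive z with toSum (f (flipHead z) ≟ f z)
  ... | inj₁ match = begin
    matchLabel (matchLabel z)  ≡⟨ cong matchLabel (twist-no flipHead mismatch? (λ m → m match)) ⟩
    matchLabel (flipHead z)    ≡⟨ twist-no flipHead mismatch? (λ m → m match′) ⟩
    flipHead (flipHead z)      ≡⟨ flipHead-involutive z ⟩
    z                          ∎
    where
      open ≡-Reasoning
      match′ : f (flipHead (flipHead z)) ≡ f (flipHead z)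
      match′ = trans (cong f (flipHead-involutive z)) (sym match)
  ... | inj₂ mismatch = begin
    matchLabel (matchLabel z)  ≡⟨ cong matchLabel (twist-yes flipHead mismatch? mismatch) ⟩
    matchLabel w               ≡⟨ twist-yes flipHead mismatch? mismatch′ ⟩
    complement (flipHead w)    ≡⟨ cong complement flipHead-w ⟩
    complement (complement z)  ≡⟨ complement-involutive z ⟩
    z                          ∎
    where
      open ≡-Reasoning
      w : Vec Bool (2 * suc k)
      w = complement (flipHead z)
      flipHead-w : flipHead w ≡ complement z
      flipHead-w = trans (flipHead-complement (flipHead z)) (cong complement (flipHead-involutive z))
      mismatch′ : f (flipHead w) ≢ f w
      mismatch′ eq = separates z (sym (trans (sym (cong f flipHead-w))
                                             (trans eq (complement-matches z mismatch))))

  matchLabel-≢ : ∀ z → matchLabel z ≢ z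
  matchLabel-≢ z with twist-UpToComplement flipHead mismatch? z
  ... | inj₁ eq = λ fixed → flipHead-≢ z (trans (sym eq) fixed)
  ... | inj₂ eq = λ fixed → m+1+n≢0 k (complement-flipHead≡id⇒n≡0 z (trans (sym eq) fixed))

  matchLabelAutomorphism : Automorphism (Ω (suc k))
  matchLabelAutomorphism = involution⇒Automorphism (Ω (suc k)) matchLabel matchLabel-involutive
                             (twist-preserves-Adj (suc k) flipHead-isometry mismatch?)

theorem3 : ∀ (k : ℕ) → 1 ≤ k → DistGreaterThan (Ω k) 2
theorem3 (suc k) _ d d≤2 f D = matchLabel-≢ d≤2 f separates z₀ (D σ preserves z₀)
  where
    separates : ∀ z → f z ≢ f (complement z)
    separates = Distinguishing⇒label≢complement-label f D

    σ : Automorphism (Ω (suc k))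
    σ = matchLabelAutomorphism d≤2 f separates

    preserves : ∀ z → f (to σ z) ≡ f z
    preserves = matchLabel-preserves-labels d≤2 f separates

    z₀ : Vec Bool (2 * suc k)
    z₀ = replicate _ false
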